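{- Let $D$ be the distance matrix of a finite tree $G=(V,E)$ with positive edge lengths $\{\alpha_e\}$, and let $S\subseteq V$ be nonempty. Then \[ \frac{\det D[S]}{\operatorname{cof} D[S]} = \max\{\mathbf{u}^\intercal D[S]\mathbf{u} : \mathbf{u}\in\mathbb{R}^S,\ \mathbf{1}^\intercal\mathbf{u}=1\}. \]
   Context: $D$ has $(u,v)$-entry the sum of $\alpha_e$ along the unique path from $u$ to $v$; $D[S]$ is the principal submatrix indexed by $S$. For a $k\times k$ matrix $M$, $\operatorname{cof}M=\sum_{i,j}(-1)^{i+j}\det M_{i,j}$, with $M_{i,j}$ obtained by deleting row $i$ and column $j$ (for $k=1$, $\operatorname{cof}M=1$). $\mathbf{1}$ is the all-ones vector. -}

module Defs where

open import Level using (Level; _⊔_)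
open import Data.Nat as ℕ using (ℕ)
open import Data.Fin as Fin using (Fin; zero; suc; toℕ; punchIn)
open import Data.Product using (Σ; ∃; _×_; _,_)
open import Relation.Nullary using (¬_)
open import Data.Unit using (⊤)
open import Algebra.Bundles using (CommutativeRing)
open import Relation.Binary.Structures using (IsTotalOrder)

-- An ordered field: a commutative ring with a total order compatible with
-- + and *, in which 1 ≠ 0 and every nonzero element has an inverse.
-- (ℝ is an instance; the theorem is stated for every ordered field.)
record OrderedField (c ℓ₁ ℓ₂ : Level) : Set (Level.suc (c ⊔ ℓ₁ ⊔ ℓ₂)) where
  field
    commutativeRing : CommutativeRing c ℓ₁
  open CommutativeRing commutativeRing public
    using (Carrier; _≈_; _+_; _*_; -_; 0#; 1#)
  field
    _≤_          : Carrier → Carrier → Set ℓ₂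
    isTotalOrder : IsTotalOrder _≈_ _≤_
    +-mono-≤     : ∀ {x y} z → x ≤ y → (x + z) ≤ (y + z)
    *-nonneg     : ∀ {x y} → 0# ≤ x → 0# ≤ y → 0# ≤ (x * y)
    1≉0          : ¬ (1# ≈ 0#)
    inverse      : ∀ x → ¬ (x ≈ 0#) → ∃ λ y → (x * y) ≈ 1#

  _<_ : Carrier → Carrier → Set (ℓ₁ ⊔ ℓ₂)
  x < y = (x ≤ y) × ¬ (x ≈ y)

module Tree {c ℓ₁ ℓ₂} (F : OrderedField c ℓ₁ ℓ₂) where
  open OrderedField F

  -- Finite trees with edge lengths, vertex set Fin n, built by attaching leaves.
  -- (Every finite tree arises this way, up to relabelling of vertices.)
  -- In  grow T p a  the new vertex is  zero , old vertex i becomes  suc i ,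
  -- and the new edge joins  zero  to  suc p  with length  a .
  data WTree : ℕ → Set c where
    single : WTree 1
    grow   : ∀ {n} → WTree (ℕ.suc n) → Fin (ℕ.suc n) → Carrier → WTree (ℕ.suc (ℕ.suc n))

  PositiveLengths : ∀ {n} → WTree n → Set (ℓ₁ ⊔ ℓ₂)
  PositiveLengths single       = Level.Lift _ ⊤
  PositiveLengths (grow T p a) = (0# < a) × PositiveLengths T

  dist : ∀ {n} → WTree n → Fin n → Fin n → Carrier
  dist single       zero    zero    = 0#
  dist (grow T p a) zero    zero    = 0#
  dist (grow T p a) zero    (suc j) = a + dist T p j
  dist (grow T p a) (suc i) zero    = dist T i p + a
  dist (grow T p a) (suc i) (suc j) = dist T i j

module Matrices {c ℓ} (R : CommutativeRing c ℓ) where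
  open CommutativeRing R using (Carrier; _+_; _*_; -_; 0#; 1#)

  Matrix : ℕ → Set c
  Matrix k = Fin k → Fin k → Carrier

  ∑ : ∀ {k} → (Fin k → Carrier) → Carrier
  ∑ {ℕ.zero}  f = 0#
  ∑ {ℕ.suc k} f = f zero + ∑ (λ i → f (suc i))

  sgn : ℕ → Carrier
  sgn ℕ.zero    = 1#
  sgn (ℕ.suc m) = - sgn m

  minor : ∀ {k} → Fin (ℕ.suc k) → Fin (ℕ.suc k) → Matrix (ℕ.suc k) → Matrix k
  minor i j M a b = M (punchIn i a) (punchIn j b)

  det : ∀ {k} → Matrix k → Carrier
  det {ℕ.zero}  M = 1#
  det {ℕ.suc k} M = ∑ λ j → sgn (toℕ j) * (M zero j * det (minor zero j M))

  cof : ∀ {k} → Matrix (ℕ.suc k) → Carrier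
  cof M = ∑ λ i → ∑ λ j → sgn (toℕ i ℕ.+ toℕ j) * det (minor i j M)

  quad : ∀ {k} → Matrix k → (Fin k → Carrier) → Carrier
  quad M u = ∑ λ i → ∑ λ j → u i * (M i j * u j)

  sub : ∀ {n k} → Matrix n → (Fin k → Fin n) → Matrix k
  sub M σ a b = M (σ a) (σ b)

-- σ strictly increasing: its image is a k-element subset S, listed in order
StrictlyIncreasing : ∀ {k n} → (Fin k → Fin n) → Set
StrictlyIncreasing σ = ∀ i j → i Fin.< j → σ i Fin.< σ j

{-# OPTIONS --safe #-}
module Submission where

-- Attaching a leaf at distance α to a tree adds α (e x - e y)² to the distance matrix,
-- e being the indicator of the new leaf; on vectors v with ∑ v = 0 this changes
-- vᵀ D v by -2α (v · e)². By induction, vᵀ D v ≤ 0 when ∑ v = 0, with equality only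
-- for v = 0, and this is inherited by principal submatrices.  For such a symmetric
-- hollow matrix M, w = adj(M) 𝟙 satisfies M w = det M · 𝟙 and ∑ w = cof M.
-- Definiteness forces det M ≠ 0 (induction on the size, since the columns of adj M
-- lie in the kernel of a singular M) and then cof M ≠ 0 (otherwise wᵀ M w = 0).
-- So u = w / cof M is admissible with M u = (det M / cof M) 𝟙, and every admissible
-- v = u + h satisfies vᵀ M v = uᵀ M u + hᵀ M h ≤ uᵀ M u = det M / cof M.

open import Defs
open import Level using (_⊔_)
open import Algebra.Bundles using (CommutativeRing)
open import Data.Empty using (⊥-elim)
open import Data.Fin as Fin using (Fin; zero; suc; toℕ; punchIn; punchOut)
import Data.Fin.Properties as Fin
open import Data.Integer using (+_)
open import Data.Nat as ℕ using (ℕ; zero; suc)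
open import Data.Product using (∃; _×_; _,_; proj₁; proj₂)
open import Data.Sum using (inj₁; inj₂)
open import Function using (_∘_)
open import Function.Definitions using (Injective)
open import Relation.Binary.Definitions using (tri<; tri≈; tri>)
open import Relation.Binary.PropositionalEquality as ≡ using (_≡_; _≢_)
open import Relation.Nullary using (¬_; yes; no)

-- The standard ring solver with integer coefficients, so that the numerals produced by
-- sgn and δ are normalised.  Interpreting naturals with _×′_ makes ⟦ +0 ⟧ and ⟦ +1 ⟧
-- reduce to 0# and 1#, as the solver's reflexivity proofs require.
module IntegerCoefficientSolver {c ℓ} (R : CommutativeRing c ℓ) where
  open import Data.Maybe using (Maybe; just; nothing)
  open import Data.Integer as ℤ using (ℤ; +_; -[1+_]; _⊖_; ∣_∣; sign; _◃_)
  import Data.Integer.Properties as ℤ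
  import Data.Nat.Properties as ℕ
  open import Data.Sign as Sign using (Sign)
  open import Algebra.Solver.Ring.AlmostCommutativeRing
    using (fromCommutativeRing; _-Raw-AlmostCommutative⟶_)
  open CommutativeRing R hiding (zero)
  open import Algebra.Properties.Semiring.Mult.TCOptimised semiring
    using (1+×; ×-homo-+; ×1-homo-*) renaming (_×_ to _×′_)
  open import Algebra.Properties.Ring ring
    using (-‿involutive; -1*x≈-x; -‿+-comm; -0#≈0#)
  open import Algebra.Properties.CommutativeSemigroup *-commutativeSemigroup
    using () renaming (interchange to *-interchange)
  open import Algebra.Properties.CommutativeSemigroup +-commutativeSemigroup
    using () renaming (interchange to +-interchange)
  open import Relation.Binary.Reasoning.Setoid setoid

  private
    ⟦_⟧ : ℤ → Carrier
    ⟦ + n ⟧      = n ×′ 1#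
    ⟦ -[1+ n ] ⟧ = - (suc n ×′ 1#)

    ⊖-homo : ∀ m n → ⟦ m ⊖ n ⟧ ≈ m ×′ 1# - n ×′ 1#
    ⊖-homo zero    zero    = sym (-‿inverseʳ 0#)
    ⊖-homo (suc m) zero    = sym (trans (+-congˡ -0#≈0#) (+-identityʳ _))
    ⊖-homo zero    (suc n) = sym (+-identityˡ _)
    ⊖-homo (suc m) (suc n) = begin
      ⟦ suc m ⊖ suc n ⟧                  ≡⟨ ≡.cong ⟦_⟧ (ℤ.[1+m]⊖[1+n]≡m⊖n m n) ⟩
      ⟦ m ⊖ n ⟧                          ≈⟨ ⊖-homo m n ⟩
      m ×′ 1# - n ×′ 1#                  ≈⟨ +-identityˡ _ ⟨
      0# + (m ×′ 1# - n ×′ 1#)           ≈⟨ +-congʳ (-‿inverseʳ 1#) ⟨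
      (1# - 1#) + (m ×′ 1# - n ×′ 1#)    ≈⟨ +-interchange _ _ _ _ ⟩
      (1# + m ×′ 1#) + (- 1# - n ×′ 1#)  ≈⟨ +-congˡ (-‿+-comm 1# _) ⟩
      (1# + m ×′ 1#) - (1# + n ×′ 1#)    ≈⟨ +-cong (1+× m 1#) (-‿cong (1+× n 1#)) ⟨
      suc m ×′ 1# - suc n ×′ 1#          ∎

    +-homo : ∀ i j → ⟦ i ℤ.+ j ⟧ ≈ ⟦ i ⟧ + ⟦ j ⟧
    +-homo (+ m)    (+ n)    = ×-homo-+ 1# m n
    +-homo (+ m)    -[1+ n ] = ⊖-homo m (suc n)
    +-homo -[1+ m ] (+ n)    = trans (⊖-homo n (suc m)) (+-comm _ _)
    +-homo -[1+ m ] -[1+ n ] = begin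
      - (suc (suc (m ℕ.+ n)) ×′ 1#)    ≡⟨ ≡.cong (λ k → - (suc k ×′ 1#)) (ℕ.+-suc m n) ⟨
      - ((suc m ℕ.+ suc n) ×′ 1#)      ≈⟨ -‿cong (×-homo-+ 1# (suc m) (suc n)) ⟩
      - (suc m ×′ 1# + suc n ×′ 1#)    ≈⟨ -‿+-comm _ _ ⟨
      - (suc m ×′ 1#) - (suc n ×′ 1#)  ∎

    signed : Sign → Carrier
    signed Sign.+ = 1#
    signed Sign.- = - 1#

    signed-homo : ∀ s t → signed (s Sign.* t) ≈ signed s * signed t
    signed-homo Sign.+ t      = sym (*-identityˡ _)
    signed-homo Sign.- Sign.+ = sym (*-identityʳ _)
    signed-homo Sign.- Sign.- = trans (sym (-‿involutive 1#)) (sym (-1*x≈-x (- 1#)))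

    ◃-homo : ∀ s n → ⟦ s ◃ n ⟧ ≈ signed s * (n ×′ 1#)
    ◃-homo s      zero    = sym (zeroʳ _)
    ◃-homo Sign.+ (suc n) = sym (*-identityˡ _)
    ◃-homo Sign.- (suc n) = sym (-1*x≈-x _)

    sign-abs : ∀ i → ⟦ i ⟧ ≈ signed (sign i) * (∣ i ∣ ×′ 1#)
    sign-abs i = trans (reflexive (≡.cong ⟦_⟧ (≡.sym (ℤ.◃-inverse i)))) (◃-homo (sign i) ∣ i ∣)

    *-homo : ∀ i j → ⟦ i ℤ.* j ⟧ ≈ ⟦ i ⟧ * ⟦ j ⟧
    *-homo i j = begin
      ⟦ sign i Sign.* sign j ◃ ∣ i ∣ ℕ.* ∣ j ∣ ⟧
        ≈⟨ ◃-homo (sign i Sign.* sign j) (∣ i ∣ ℕ.* ∣ j ∣) ⟩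
      signed (sign i Sign.* sign j) * ((∣ i ∣ ℕ.* ∣ j ∣) ×′ 1#)
        ≈⟨ *-cong (signed-homo (sign i) (sign j)) (×1-homo-* ∣ i ∣ ∣ j ∣) ⟩
      (signed (sign i) * signed (sign j)) * ((∣ i ∣ ×′ 1#) * (∣ j ∣ ×′ 1#))
        ≈⟨ *-interchange _ _ _ _ ⟩
      (signed (sign i) * (∣ i ∣ ×′ 1#)) * (signed (sign j) * (∣ j ∣ ×′ 1#))
        ≈⟨ *-cong (sign-abs i) (sign-abs j) ⟨
      ⟦ i ⟧ * ⟦ j ⟧ ∎

    -‿homo : ∀ i → ⟦ ℤ.- i ⟧ ≈ - ⟦ i ⟧
    -‿homo (+ zero)  = sym -0#≈0#
    -‿homo (+ suc n) = refl
    -‿homo -[1+ n ]  = sym (-‿involutive _)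

    homomorphism : ℤ.+-*-rawRing -Raw-AlmostCommutative⟶ fromCommutativeRing R
    homomorphism = record
      { ⟦_⟧ = ⟦_⟧ ; +-homo = +-homo ; *-homo = *-homo ; -‿homo = -‿homo
      ; 0-homo = refl ; 1-homo = refl }

    coefficient≟ : ∀ i j → Maybe (⟦ i ⟧ ≈ ⟦ j ⟧)
    coefficient≟ i j with i ℤ.≟ j
    ... | yes ≡.refl = just refl
    ... | no _       = nothing

  open import Algebra.Solver.Ring ℤ.+-*-rawRing (fromCommutativeRing R) homomorphism coefficient≟
    public

module FiniteSums {c ℓ} (R : CommutativeRing c ℓ) where
  open CommutativeRing R hiding (zero)
  open Matrices R
  open import Algebra.Properties.Semiring.Sum semiring as Sum using (sum)
  open import Algebra.Properties.Ring ring using (-1*x≈-x)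
  open IntegerCoefficientSolver R
  open import Relation.Binary.Reasoning.Setoid setoid

  ∑≡sum : ∀ {k} (f : Fin k → Carrier) → ∑ f ≡ sum f
  ∑≡sum {zero}  f = ≡.refl
  ∑≡sum {suc k} f = ≡.cong (λ s → f zero + s) (∑≡sum (λ i → f (suc i)))

  ∑-cong : ∀ {k} {f g : Fin k → Carrier} → (∀ i → f i ≈ g i) → ∑ f ≈ ∑ g
  ∑-cong {f = f} {g} f≈g = begin
    ∑ f   ≡⟨ ∑≡sum f ⟩
    sum f ≈⟨ Sum.sum-cong-≋ f≈g ⟩
    sum g ≡⟨ ∑≡sum g ⟨
    ∑ g   ∎

  ∑-zero : ∀ {k} {f : Fin k → Carrier} → (∀ i → f i ≈ 0#) → ∑ f ≈ 0#
  ∑-zero {k} f≈0 = trans (∑-cong f≈0) (trans (reflexive (∑≡sum {k} (λ _ → 0#))) (Sum.sum-replicate-zero k))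

  ∑-distrib-+ : ∀ {k} (f g : Fin k → Carrier) → ∑ (λ i → f i + g i) ≈ ∑ f + ∑ g
  ∑-distrib-+ f g = begin
    ∑ (λ i → f i + g i)   ≡⟨ ∑≡sum (λ i → f i + g i) ⟩
    sum (λ i → f i + g i) ≈⟨ Sum.∑-distrib-+ f g ⟩
    sum f + sum g         ≡⟨ ≡.cong₂ _+_ (∑≡sum f) (∑≡sum g) ⟨
    ∑ f + ∑ g             ∎

  ∑-comm : ∀ {k m} (f : Fin k → Fin m → Carrier) →
           ∑ (λ i → ∑ (λ j → f i j)) ≈ ∑ (λ j → ∑ (λ i → f i j))
  ∑-comm f = begin
    ∑ (λ i → ∑ (λ j → f i j))     ≈⟨ ∑-cong (λ i → reflexive (∑≡sum (f i))) ⟩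
    ∑ (λ i → sum (λ j → f i j))   ≡⟨ ∑≡sum (λ i → sum (λ j → f i j)) ⟩
    sum (λ i → sum (λ j → f i j)) ≈⟨ Sum.∑-comm f ⟩
    sum (λ j → sum (λ i → f i j)) ≡⟨ ∑≡sum (λ j → sum (λ i → f i j)) ⟨
    ∑ (λ j → sum (λ i → f i j))   ≈⟨ ∑-cong (λ j → reflexive (∑≡sum (λ i → f i j))) ⟨
    ∑ (λ j → ∑ (λ i → f i j))     ∎

  *-distribˡ-∑ : ∀ {k} a (f : Fin k → Carrier) → a * ∑ f ≈ ∑ (λ i → a * f i)
  *-distribˡ-∑ a f = begin
    a * ∑ f               ≡⟨ ≡.cong (a *_) (∑≡sum f) ⟩
    a * sum f             ≈⟨ Sum.*-distribˡ-sum a f ⟩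
    sum (λ i → a * f i)   ≡⟨ ∑≡sum (λ i → a * f i) ⟨
    ∑ (λ i → a * f i)     ∎

  *-distribʳ-∑ : ∀ {k} a (f : Fin k → Carrier) → ∑ f * a ≈ ∑ (λ i → f i * a)
  *-distribʳ-∑ a f = trans (*-comm _ a) (trans (*-distribˡ-∑ a f) (∑-cong (λ i → *-comm a (f i))))

  -‿distrib-∑ : ∀ {k} (f : Fin k → Carrier) → - ∑ f ≈ ∑ (λ i → - f i)
  -‿distrib-∑ f = begin
    - ∑ f               ≈⟨ -1*x≈-x (∑ f) ⟨
    - 1# * ∑ f          ≈⟨ *-distribˡ-∑ (- 1#) f ⟩
    ∑ (λ i → - 1# * f i) ≈⟨ ∑-cong (λ i → -1*x≈-x (f i)) ⟩
    ∑ (λ i → - f i)     ∎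

  ∑-remove : ∀ {k} (i : Fin (suc k)) (f : Fin (suc k) → Carrier) →
             ∑ f ≈ f i + ∑ (λ a → f (punchIn i a))
  ∑-remove i f = begin
    ∑ f                           ≡⟨ ∑≡sum f ⟩
    sum f                         ≈⟨ Sum.sum-remove f ⟩
    f i + sum (λ a → f (punchIn i a)) ≡⟨ ≡.cong (λ s → f i + s) (∑≡sum (λ a → f (punchIn i a))) ⟨
    f i + ∑ (λ a → f (punchIn i a))   ∎

  ∑∑ : ∀ {k m} → (Fin k → Fin m → Carrier) → Carrier
  ∑∑ f = ∑ (λ i → ∑ (λ j → f i j))

  ∑∑-cong : ∀ {k m} {f g : Fin k → Fin m → Carrier} → (∀ i j → f i j ≈ g i j) → ∑∑ f ≈ ∑∑ g
  ∑∑-cong f≈g = ∑-cong (λ i → ∑-cong (f≈g i))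

  ∑∑-distrib-+ : ∀ {k m} (f g : Fin k → Fin m → Carrier) →
                 ∑∑ (λ i j → f i j + g i j) ≈ ∑∑ f + ∑∑ g
  ∑∑-distrib-+ f g =
    trans (∑-cong (λ i → ∑-distrib-+ (f i) (g i))) (∑-distrib-+ (λ i → ∑ (f i)) (λ i → ∑ (g i)))

  *-distribˡ-∑∑ : ∀ {k m} a (f : Fin k → Fin m → Carrier) → a * ∑∑ f ≈ ∑∑ (λ i j → a * f i j)
  *-distribˡ-∑∑ a f = trans (*-distribˡ-∑ a (λ i → ∑ (f i))) (∑-cong (λ i → *-distribˡ-∑ a (f i)))

  ∑∑-* : ∀ {k m} (f : Fin k → Carrier) (g : Fin m → Carrier) → ∑∑ (λ i j → f i * g j) ≈ ∑ f * ∑ g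
  ∑∑-* f g = begin
    ∑∑ (λ i j → f i * g j)  ≈⟨ ∑-cong (λ i → *-distribˡ-∑ (f i) g) ⟨
    ∑ (λ i → f i * ∑ g)     ≈⟨ *-distribʳ-∑ (∑ g) f ⟨
    ∑ f * ∑ g               ∎

  ∑∑-antisymmetric : ∀ {k} (A : Fin k → Fin k → Carrier) → (∀ i → A i i ≈ 0#) →
                     (∀ i j → A i j ≈ - A j i) → ∑∑ A ≈ 0#
  ∑∑-antisymmetric {zero}  A diag anti = refl
  ∑∑-antisymmetric {suc k} A diag anti = begin
    ∑∑ A
      ≈⟨ ∑-distrib-+ (λ i → A i zero) (λ i → ∑ (λ j → A i (suc j))) ⟩
    (A zero zero + ∑ (λ i → A (suc i) zero)) + (∑ (λ j → A zero (suc j)) + ∑∑ (λ i j → A (suc i) (suc j)))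
      ≈⟨ +-cong (+-congʳ (diag zero))
                (+-congˡ (∑∑-antisymmetric _ (diag ∘ suc) (λ i j → anti (suc i) (suc j)))) ⟩
    (0# + ∑ (λ i → A (suc i) zero)) + (∑ (λ j → A zero (suc j)) + 0#)
      ≈⟨ solve 2 (λ a b → (con (+ 0) :+ a) :+ (b :+ con (+ 0)) := a :+ b) refl _ _ ⟩
    ∑ (λ i → A (suc i) zero) + ∑ (λ j → A zero (suc j))
      ≈⟨ ∑-distrib-+ (λ i → A (suc i) zero) (λ j → A zero (suc j)) ⟨
    ∑ (λ i → A (suc i) zero + A zero (suc i))
      ≈⟨ ∑-zero (λ i → trans (+-congʳ (anti (suc i) zero)) (-‿inverseˡ _)) ⟩
    0# ∎

  δ : ∀ {k} → Fin k → Fin k → Carrier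
  δ zero    zero    = 1#
  δ zero    (suc _) = 0#
  δ (suc _) zero    = 0#
  δ (suc i) (suc j) = δ i j

  δ-refl : ∀ {k} (i : Fin k) → δ i i ≡ 1#
  δ-refl zero    = ≡.refl
  δ-refl (suc i) = δ-refl i

  δ-≢ : ∀ {k} {i j : Fin k} → i ≢ j → δ i j ≡ 0#
  δ-≢ {i = zero}  {zero}  i≢j = ⊥-elim (i≢j ≡.refl)
  δ-≢ {i = zero}  {suc j} i≢j = ≡.refl
  δ-≢ {i = suc i} {zero}  i≢j = ≡.refl
  δ-≢ {i = suc i} {suc j} i≢j = δ-≢ (i≢j ∘ ≡.cong suc)

  δ-sym : ∀ {k} (i j : Fin k) → δ i j ≡ δ j i
  δ-sym zero    zero    = ≡.refl
  δ-sym zero    (suc j) = ≡.refl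
  δ-sym (suc i) zero    = ≡.refl
  δ-sym (suc i) (suc j) = δ-sym i j

  δ-injective : ∀ {k m} {f : Fin k → Fin m} → Injective _≡_ _≡_ f → ∀ i j → δ (f i) (f j) ≡ δ i j
  δ-injective {f = f} f-inj i j with i Fin.≟ j
  ... | yes ≡.refl = ≡.trans (δ-refl (f i)) (≡.sym (δ-refl i))
  ... | no i≢j     = ≡.trans (δ-≢ (i≢j ∘ f-inj)) (≡.sym (δ-≢ i≢j))

  ∑-δ : ∀ {k} (i : Fin k) (f : Fin k → Carrier) → ∑ (λ a → δ i a * f a) ≈ f i
  ∑-δ zero    f = trans (+-cong (*-identityˡ _) (∑-zero (λ a → zeroˡ (f (suc a))))) (+-identityʳ _)
  ∑-δ (suc i) f = trans (+-cong (zeroˡ _) (∑-δ i (λ a → f (suc a)))) (+-identityˡ _)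

module QuadraticForms {c ℓ} (R : CommutativeRing c ℓ) where
  open CommutativeRing R hiding (zero)
  open Matrices R
  open FiniteSums R
  open IntegerCoefficientSolver R
  open import Relation.Binary.Reasoning.Setoid setoid

  Vector : ℕ → Set c
  Vector k = Fin k → Carrier

  ⟨_,_⟩ : ∀ {k} → Vector k → Vector k → Carrier
  ⟨ u , v ⟩ = ∑ (λ i → u i * v i)

  infixr 7 _*ᵥ_
  _*ᵥ_ : ∀ {k} → Matrix k → Vector k → Vector k
  (M *ᵥ v) i = ⟨ M i , v ⟩

  bilinear : ∀ {k} → Matrix k → Vector k → Vector k → Carrier
  bilinear M u v = ∑∑ (λ i j → u i * (M i j * v j))

  ⟨⟩-comm : ∀ {k} (u v : Vector k) → ⟨ u , v ⟩ ≈ ⟨ v , u ⟩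
  ⟨⟩-comm u v = ∑-cong (λ i → *-comm (u i) (v i))

  bilinear-*ᵥ : ∀ {k} (M : Matrix k) u v → bilinear M u v ≈ ⟨ u , M *ᵥ v ⟩
  bilinear-*ᵥ M u v = ∑-cong (λ i → sym (*-distribˡ-∑ (u i) (λ j → M i j * v j)))

  bilinear-sym : ∀ {k} {M : Matrix k} → (∀ i j → M i j ≈ M j i) → ∀ u v →
                 bilinear M u v ≈ bilinear M v u
  bilinear-sym {k} {M} M-sym u v = trans (∑-comm {k} {k} _) (∑∑-cong λ j i → begin
    u i * (M i j * v j) ≈⟨ *-congˡ (*-congʳ (M-sym i j)) ⟩
    u i * (M j i * v j) ≈⟨ solve 3 (λ a m b → a :* (m :* b) := b :* (m :* a)) refl (u i) (M j i) (v j) ⟩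
    v j * (M j i * u i) ∎)

  bilinear-const : ∀ {k} (M : Matrix k) u v {r} → (∀ i → (M *ᵥ v) i ≈ r) → bilinear M u v ≈ ∑ u * r
  bilinear-const M u v {r} Mv≈r = begin
    bilinear M u v          ≈⟨ bilinear-*ᵥ M u v ⟩
    ⟨ u , M *ᵥ v ⟩          ≈⟨ ∑-cong (λ i → *-congˡ (Mv≈r i)) ⟩
    ∑ (λ i → u i * r)       ≈⟨ *-distribʳ-∑ r u ⟨
    ∑ u * r                 ∎

  quad-cong : ∀ {k} {M N : Matrix k} {u v} → (∀ i j → M i j ≈ N i j) → (∀ i → u i ≈ v i) →
              quad M u ≈ quad N v
  quad-cong M≈N u≈v = ∑∑-cong (λ i j → *-cong (u≈v i) (*-cong (M≈N i j) (u≈v j)))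

  quad-+ : ∀ {k} (M : Matrix k) (u h : Vector k) →
           quad M (λ i → u i + h i) ≈ ((quad M u + bilinear M u h) + bilinear M h u) + quad M h
  quad-+ {k} M u h = begin
    quad M (λ i → u i + h i)
      ≈⟨ ∑∑-cong (λ i j → solve 5 (λ a b m p q →
           (a :+ p) :* (m :* (b :+ q)) := ((a :* (m :* b) :+ a :* (m :* q)) :+ p :* (m :* b)) :+ p :* (m :* q))
           refl (u i) (u j) (M i j) (h i) (h j)) ⟩
    ∑∑ (λ i j → ((u i * (M i j * u j) + u i * (M i j * h j)) + h i * (M i j * u j)) + h i * (M i j * h j))
      ≈⟨ ∑∑-distrib-+ {k} {k} _ _ ⟩
    ∑∑ (λ i j → (u i * (M i j * u j) + u i * (M i j * h j)) + h i * (M i j * u j)) + quad M h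
      ≈⟨ +-congʳ (trans (∑∑-distrib-+ {k} {k} _ _) (+-congʳ (∑∑-distrib-+ {k} {k} _ _))) ⟩
    ((quad M u + bilinear M u h) + bilinear M h u) + quad M h ∎

  quad-+-* : ∀ {k} (M N : Matrix k) a v →
             quad (λ i j → M i j + a * N i j) v ≈ quad M v + a * quad N v
  quad-+-* {k} M N a v = begin
    quad (λ i j → M i j + a * N i j) v
      ≈⟨ ∑∑-cong (λ i j → solve 5 (λ x y m n a →
           x :* ((m :+ a :* n) :* y) := x :* (m :* y) :+ a :* (x :* (n :* y)))
           refl (v i) (v j) (M i j) (N i j) a) ⟩
    ∑∑ (λ i j → v i * (M i j * v j) + a * (v i * (N i j * v j)))
      ≈⟨ ∑∑-distrib-+ {k} {k} _ _ ⟩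
    quad M v + ∑∑ (λ i j → a * (v i * (N i j * v j)))
      ≈⟨ +-congˡ (*-distribˡ-∑∑ {k} {k} a _) ⟨
    quad M v + a * quad N v ∎

  quad-δ : ∀ {k} (M : Matrix k) i t → quad M (λ a → δ i a * t) ≈ t * (M i i * t)
  quad-δ {k} M i t = begin
    quad M (λ a → δ i a * t)
      ≈⟨ ∑∑-cong (λ a b → solve 5 (λ d e t m f → (d :* t) :* (m :* (e :* t)) := d :* (e :* (t :* (m :* t))))
           refl (δ i a) (δ i b) t (M a b) t) ⟩
    ∑ (λ a → ∑ (λ b → δ i a * (δ i b * (t * (M a b * t)))))
      ≈⟨ ∑-cong (λ a → sym (*-distribˡ-∑ {k} (δ i a) _)) ⟩
    ∑ (λ a → δ i a * ∑ (λ b → δ i b * (t * (M a b * t))))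
      ≈⟨ ∑-cong (λ a → *-congˡ (∑-δ i (λ b → t * (M a b * t)))) ⟩
    ∑ (λ a → δ i a * (t * (M a i * t)))
      ≈⟨ ∑-δ i (λ a → t * (M a i * t)) ⟩
    t * (M i i * t) ∎

  quad-squaredDifference : ∀ {k} (g v : Vector k) → ∑ v ≈ 0# →
    let s = ⟨ g , v ⟩ in quad (λ i j → (g i - g j) * (g i - g j)) v ≈ - (s * s + s * s)
  quad-squaredDifference {k} g v ∑v≈0 = begin
    quad (λ i j → (g i - g j) * (g i - g j)) v
      ≈⟨ ∑∑-cong (λ i j → solve 4 (λ x y a b →
           x :* (((a :- b) :* (a :- b)) :* y)
             := ((a :* a) :* x) :* y :+ x :* ((b :* b) :* y) :+ (:- (a :* x :+ a :* x)) :* (b :* y))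
           refl (v i) (v j) (g i) (g j)) ⟩
    ∑∑ (λ i j → A i * v j + v i * A j + D i * C j)
      ≈⟨ trans (∑∑-distrib-+ {k} {k} _ _) (+-congʳ (∑∑-distrib-+ {k} {k} _ _)) ⟩
    ∑∑ (λ i j → A i * v j) + ∑∑ (λ i j → v i * A j) + ∑∑ (λ i j → D i * C j)
      ≈⟨ +-cong (+-cong (∑∑-* A v) (∑∑-* v A)) (∑∑-* D C) ⟩
    ∑ A * ∑ v + ∑ v * ∑ A + ∑ D * s
      ≈⟨ +-cong (+-cong (*-congˡ ∑v≈0) (*-congʳ ∑v≈0)) (*-congʳ ∑D≈-2s) ⟩
    ∑ A * 0# + 0# * ∑ A + - (s + s) * s
      ≈⟨ solve 2 (λ a s → a :* con (+ 0) :+ con (+ 0) :* a :+ (:- (s :+ s)) :* s := :- (s :* s :+ s :* s))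
           refl (∑ A) s ⟩
    - (s * s + s * s) ∎
    where
    s : Carrier
    s = ⟨ g , v ⟩
    A C D : Vector k
    A i = (g i * g i) * v i
    C i = g i * v i
    D i = - (C i + C i)
    ∑D≈-2s : ∑ D ≈ - (s + s)
    ∑D≈-2s = trans (sym (-‿distrib-∑ (λ i → C i + C i))) (-‿cong (∑-distrib-+ C C))

  push : ∀ {k m} → (Fin k → Fin m) → Vector k → Vector m
  push f v y = ∑ (λ a → δ (f a) y * v a)

  ∑-push : ∀ {k m} (f : Fin k → Fin m) v → ∑ (push f v) ≈ ∑ v
  ∑-push {k} {m} f v = begin
    ∑ (push f v)                          ≈⟨ ∑-comm {m} {k} _ ⟩
    ∑ (λ a → ∑ (λ y → δ (f a) y * v a))   ≈⟨ ∑-cong (λ a → ∑-δ (f a) (λ _ → v a)) ⟩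
    ∑ v                                   ∎

  ⟨push,⟩ : ∀ {k m} (f : Fin k → Fin m) v g → ⟨ push f v , g ⟩ ≈ ⟨ v , (λ a → g (f a)) ⟩
  ⟨push,⟩ {k} {m} f v g = begin
    ⟨ push f v , g ⟩
      ≈⟨ ∑-cong (λ y → *-distribʳ-∑ (g y) (λ a → δ (f a) y * v a)) ⟩
    ∑ (λ y → ∑ (λ a → (δ (f a) y * v a) * g y))
      ≈⟨ ∑-comm {m} {k} _ ⟩
    ∑ (λ a → ∑ (λ y → (δ (f a) y * v a) * g y))
      ≈⟨ ∑∑-cong (λ a y → *-assoc (δ (f a) y) (v a) (g y)) ⟩
    ∑ (λ a → ∑ (λ y → δ (f a) y * (v a * g y)))
      ≈⟨ ∑-cong (λ a → ∑-δ (f a) (λ y → v a * g y)) ⟩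
    ⟨ v , (λ a → g (f a)) ⟩ ∎

  quad-push : ∀ {k m} (M : Matrix m) (f : Fin k → Fin m) v → quad (sub M f) v ≈ quad M (push f v)
  quad-push M f v = begin
    quad (sub M f) v                           ≈⟨ bilinear-*ᵥ (sub M f) v v ⟩
    ⟨ v , sub M f *ᵥ v ⟩                       ≈⟨ ∑-cong (λ a → *-congˡ (row a)) ⟩
    ⟨ v , (λ a → (M *ᵥ push f v) (f a)) ⟩      ≈⟨ ⟨push,⟩ f v (M *ᵥ push f v) ⟨
    ⟨ push f v , M *ᵥ push f v ⟩               ≈⟨ bilinear-*ᵥ M (push f v) (push f v) ⟨
    quad M (push f v)                          ∎
    where
    row : ∀ a → (sub M f *ᵥ v) a ≈ (M *ᵥ push f v) (f a)
    row a = begin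
      ⟨ (λ b → M (f a) (f b)) , v ⟩   ≈⟨ ⟨⟩-comm _ v ⟩
      ⟨ v , (λ b → M (f a) (f b)) ⟩   ≈⟨ ⟨push,⟩ f v (M (f a)) ⟨
      ⟨ push f v , M (f a) ⟩          ≈⟨ ⟨⟩-comm (push f v) _ ⟩
      ⟨ M (f a) , push f v ⟩          ∎

  push-injective : ∀ {k m} {f : Fin k → Fin m} → Injective _≡_ _≡_ f → ∀ v i → push f v (f i) ≈ v i
  push-injective {f = f} f-inj v i = begin
    ∑ (λ a → δ (f a) (f i) * v a)
      ≈⟨ ∑-cong (λ a → *-congʳ (reflexive (≡.trans (δ-injective f-inj a i) (δ-sym a i)))) ⟩
    ∑ (λ a → δ i a * v a)
      ≈⟨ ∑-δ i v ⟩
    v i ∎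

module Determinants {c ℓ} (R : CommutativeRing c ℓ) where
  open CommutativeRing R hiding (zero)
  open Matrices R
  open FiniteSums R
  open QuadraticForms R using (Vector; _*ᵥ_)
  open IntegerCoefficientSolver R
  open import Algebra.Properties.Ring ring using (-‿distribˡ-*; -0#≈0#)
  open import Relation.Binary.Reasoning.Setoid setoid

  sgn-+ : ∀ m n → sgn (m ℕ.+ n) ≈ sgn m * sgn n
  sgn-+ zero    n = sym (*-identityˡ _)
  sgn-+ (suc m) n = trans (-‿cong (sgn-+ m n)) (-‿distribˡ-* (sgn m) (sgn n))

  sgn-*-sgn : ∀ m x → sgn m * (sgn m * x) ≈ x
  sgn-*-sgn zero    x = trans (*-identityˡ _) (*-identityˡ x)
  sgn-*-sgn (suc m) x = trans (solve 2 (λ s x → :- s :* (:- s :* x) := s :* (s :* x)) refl (sgn m) x) (sgn-*-sgn m x)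

  sgn-punchOut : ∀ {k} {c₁ c₂ : Fin (suc k)} (c₁≢c₂ : c₁ ≢ c₂) (c₂≢c₁ : c₂ ≢ c₁) →
    sgn (toℕ c₁) * sgn (toℕ (punchOut c₁≢c₂)) ≈ - (sgn (toℕ c₂) * sgn (toℕ (punchOut c₂≢c₁)))
  sgn-punchOut {c₁ = zero} {zero}  c₁≢c₂ _ = ⊥-elim (c₁≢c₂ ≡.refl)
  sgn-punchOut {suc k} {zero}   {suc c₂} _     _ = solve 1 (λ s → con (+ 1) :* s := :- (:- s :* con (+ 1))) refl _
  sgn-punchOut {suc k} {suc c₁} {zero}   _     _ = solve 1 (λ s → :- s :* con (+ 1) := :- (con (+ 1) :* s)) refl _
  sgn-punchOut {suc k} {suc c₁} {suc c₂} c₁≢c₂ c₂≢c₁ = begin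
    - sgn (toℕ c₁) * - sgn (toℕ (punchOut (c₁≢c₂ ∘ ≡.cong suc)))
      ≈⟨ solve 2 (λ a b → :- a :* :- b := a :* b) refl _ _ ⟩
    sgn (toℕ c₁) * sgn (toℕ (punchOut (c₁≢c₂ ∘ ≡.cong suc)))
      ≈⟨ sgn-punchOut (c₁≢c₂ ∘ ≡.cong suc) (c₂≢c₁ ∘ ≡.cong suc) ⟩
    - (sgn (toℕ c₂) * sgn (toℕ (punchOut (c₂≢c₁ ∘ ≡.cong suc))))
      ≈⟨ solve 2 (λ a b → :- (a :* b) := :- (:- a :* :- b)) refl _ _ ⟩
    - (- sgn (toℕ c₂) * - sgn (toℕ (punchOut (c₂≢c₁ ∘ ≡.cong suc)))) ∎

  punchIn-punchOut-comm : ∀ {k} {c₁ c₂ : Fin (suc (suc k))} (c₁≢c₂ : c₁ ≢ c₂) (c₂≢c₁ : c₂ ≢ c₁) b →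
    punchIn c₁ (punchIn (punchOut c₁≢c₂) b) ≡ punchIn c₂ (punchIn (punchOut c₂≢c₁) b)
  punchIn-punchOut-comm {c₁ = zero}   {zero}   c₁≢c₂ _ b = ⊥-elim (c₁≢c₂ ≡.refl)
  punchIn-punchOut-comm {c₁ = zero}   {suc c₂} _     _ b = ≡.refl
  punchIn-punchOut-comm {c₁ = suc c₁} {zero}   _     _ b = ≡.refl
  punchIn-punchOut-comm {c₁ = suc c₁} {suc c₂} _     _ zero = ≡.refl
  punchIn-punchOut-comm {k = suc k} {suc c₁} {suc c₂} c₁≢c₂ c₂≢c₁ (suc b) =
    ≡.cong suc (punchIn-punchOut-comm _ _ b)

  det-cong : ∀ {k} {M N : Matrix k} → (∀ i j → M i j ≈ N i j) → det M ≈ det N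
  det-cong {zero}  M≈N = refl
  det-cong {suc k} M≈N = ∑-cong λ j →
    *-congˡ {sgn (toℕ j)} (*-cong (M≈N zero j) (det-cong (λ a b → M≈N (suc a) (punchIn j b))))

  swap₀₁ : ∀ {k} → Matrix (suc (suc k)) → Matrix (suc (suc k))
  swap₀₁ M zero          = M (suc zero)
  swap₀₁ M (suc zero)    = M zero
  swap₀₁ M (suc (suc i)) = M (suc (suc i))

  -- The part of the expansion of det M along rows 0 and 1 that takes column c₁ from row 0
  -- and column c₂ from row 1; exchanging the two rows negates it with c₁, c₂ swapped.
  pairTerm : ∀ {k} → Matrix (suc (suc k)) → Fin (suc (suc k)) → Fin (suc (suc k)) → Carrier
  pairTerm M c₁ c₂ with c₁ Fin.≟ c₂
  ... | yes _    = 0#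
  ... | no c₁≢c₂ = (sgn (toℕ c₁) * sgn (toℕ (punchOut c₁≢c₂)))
                 * ((M zero c₁ * M (suc zero) c₂)
                   * det (λ a b → M (suc (suc a)) (punchIn c₁ (punchIn (punchOut c₁≢c₂) b))))

  pairTerm-diag : ∀ {k} (M : Matrix (suc (suc k))) c → pairTerm M c c ≈ 0#
  pairTerm-diag M c with c Fin.≟ c
  ... | yes _  = refl
  ... | no c≢c = ⊥-elim (c≢c ≡.refl)

  pairTerm-punchIn : ∀ {k} (M : Matrix (suc (suc k))) j j' → pairTerm M j (punchIn j j') ≈
    (sgn (toℕ j) * sgn (toℕ j')) * ((M zero j * M (suc zero) (punchIn j j')) * det (minor zero j' (minor zero j M)))
  pairTerm-punchIn M j j' with j Fin.≟ punchIn j j'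
  ... | yes j≡ = ⊥-elim (Fin.punchInᵢ≢i j j' (≡.sym j≡))
  ... | no j≢  = reflexive (≡.cong (λ t → (sgn (toℕ j) * sgn (toℕ t))
                   * ((M zero j * M (suc zero) (punchIn j j')) * det (λ a b → M (suc (suc a)) (punchIn j (punchIn t b)))))
                   (≡.trans (Fin.punchOut-cong j ≡.refl) (Fin.punchOut-punchIn j)))

  det-pairTerms : ∀ {k} (M : Matrix (suc (suc k))) → det M ≈ ∑∑ (pairTerm M)
  det-pairTerms M = ∑-cong λ j → begin
    sgn (toℕ j) * (M zero j * ∑ (λ j' → sgn (toℕ j') * (M (suc zero) (punchIn j j') * K j j')))
      ≈⟨ *-congˡ (*-distribˡ-∑ (M zero j) (λ j' → sgn (toℕ j') * (M (suc zero) (punchIn j j') * K j j'))) ⟩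
    sgn (toℕ j) * ∑ (λ j' → M zero j * (sgn (toℕ j') * (M (suc zero) (punchIn j j') * K j j')))
      ≈⟨ *-distribˡ-∑ (sgn (toℕ j)) (λ j' → M zero j * (sgn (toℕ j') * (M (suc zero) (punchIn j j') * K j j'))) ⟩
    ∑ (λ j' → sgn (toℕ j) * (M zero j * (sgn (toℕ j') * (M (suc zero) (punchIn j j') * K j j'))))
      ≈⟨ ∑-cong (λ j' → trans (solve 5 (λ s m s' m' d → s :* (m :* (s' :* (m' :* d))) := (s :* s') :* ((m :* m') :* d))
                  refl _ _ _ _ _) (sym (pairTerm-punchIn M j j'))) ⟩
    ∑ (λ j' → pairTerm M j (punchIn j j'))
      ≈⟨ +-identityˡ _ ⟨
    0# + ∑ (λ j' → pairTerm M j (punchIn j j'))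
      ≈⟨ +-congʳ (pairTerm-diag M j) ⟨
    pairTerm M j j + ∑ (λ j' → pairTerm M j (punchIn j j'))
      ≈⟨ ∑-remove j (pairTerm M j) ⟨
    ∑ (pairTerm M j) ∎
    where
    K : Fin (suc (suc _)) → Fin (suc _) → Carrier
    K j j' = det (minor zero j' (minor zero j M))

  pairTerm-swap : ∀ {k} {M N : Matrix (suc (suc k))} → (∀ i j → N i j ≈ swap₀₁ M i j) →
                  ∀ c₁ c₂ → pairTerm N c₁ c₂ ≈ - pairTerm M c₂ c₁
  pairTerm-swap {M = M} {N} N≈ c₁ c₂ with c₁ Fin.≟ c₂ | c₂ Fin.≟ c₁
  ... | yes _       | yes _       = sym -0#≈0#
  ... | yes c₁≡c₂   | no c₂≢c₁    = ⊥-elim (c₂≢c₁ (≡.sym c₁≡c₂))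
  ... | no c₁≢c₂    | yes c₂≡c₁   = ⊥-elim (c₁≢c₂ (≡.sym c₂≡c₁))
  ... | no c₁≢c₂    | no c₂≢c₁    = begin
    (sgn (toℕ c₁) * sgn (toℕ (punchOut c₁≢c₂))) * ((N zero c₁ * N (suc zero) c₂) * det (rest N c₁≢c₂))
      ≈⟨ *-cong (sgn-punchOut c₁≢c₂ c₂≢c₁) (*-cong (*-cong (N≈ zero c₁) (N≈ (suc zero) c₂))
           (det-cong λ a b → trans (N≈ (suc (suc a)) _)
             (reflexive (≡.cong (M (suc (suc a))) (punchIn-punchOut-comm c₁≢c₂ c₂≢c₁ b))))) ⟩
    (- (sgn (toℕ c₂) * sgn (toℕ (punchOut c₂≢c₁)))) * ((M (suc zero) c₁ * M zero c₂) * det (rest M c₂≢c₁))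
      ≈⟨ solve 4 (λ s a b d → :- s :* ((a :* b) :* d) := :- (s :* ((b :* a) :* d))) refl _ _ _ _ ⟩
    - ((sgn (toℕ c₂) * sgn (toℕ (punchOut c₂≢c₁)))
        * ((M zero c₂ * M (suc zero) c₁) * det (rest M c₂≢c₁))) ∎
    where
    rest : ∀ (L : Matrix _) {c c'} → c ≢ c' → Matrix _
    rest L {c} c≢c' a b = L (suc (suc a)) (punchIn c (punchIn (punchOut c≢c') b))

  det-swap₀₁ : ∀ {k} (M : Matrix (suc (suc k))) → det (swap₀₁ M) ≈ - det M
  det-swap₀₁ M = begin
    det (swap₀₁ M)                               ≈⟨ det-pairTerms (swap₀₁ M) ⟩
    ∑∑ (pairTerm (swap₀₁ M))                     ≈⟨ ∑∑-cong (pairTerm-swap {M = M} (λ _ _ → refl)) ⟩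
    ∑∑ (λ c₁ c₂ → - pairTerm M c₂ c₁)            ≈⟨ ∑-comm (λ c₁ c₂ → - pairTerm M c₂ c₁) ⟩
    ∑ (λ c₂ → ∑ (λ c₁ → - pairTerm M c₂ c₁))     ≈⟨ ∑-cong (λ c₂ → -‿distrib-∑ (pairTerm M c₂)) ⟨
    ∑ (λ c₂ → - ∑ (pairTerm M c₂))               ≈⟨ -‿distrib-∑ (λ c₂ → ∑ (pairTerm M c₂)) ⟨
    - ∑∑ (pairTerm M)                            ≈⟨ -‿cong (det-pairTerms M) ⟨
    - det M                                      ∎

  det-equalRows₀₁ : ∀ {k} {M : Matrix (suc (suc k))} → (∀ j → M zero j ≈ M (suc zero) j) → det M ≈ 0#
  det-equalRows₀₁ {M = M} row₀≈row₁ = trans (det-pairTerms M)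
    (∑∑-antisymmetric (pairTerm M) (pairTerm-diag M) (pairTerm-swap M≈swap₀₁M))
    where
    M≈swap₀₁M : ∀ i j → M i j ≈ swap₀₁ M i j
    M≈swap₀₁M zero          j = row₀≈row₁ j
    M≈swap₀₁M (suc zero)    j = sym (row₀≈row₁ j)
    M≈swap₀₁M (suc (suc i)) j = refl

  withTopRow : ∀ {k} {A : Set c} → A → Fin (suc k) → (Fin (suc k) → A) → Fin (suc k) → A
  withTopRow r l M zero    = r
  withTopRow r l M (suc a) = M (punchIn l a)

  det-moveRowToTop : ∀ {k} (l : Fin (suc k)) (M : Matrix (suc k)) → det (withTopRow (M l) l M) ≈ sgn (toℕ l) * det M
  det-moveRowToTop zero M = trans (det-cong same) (sym (*-identityˡ _))
    where
    same : ∀ i j → withTopRow (M zero) zero M i j ≈ M i j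
    same zero    j = refl
    same (suc i) j = refl
  det-moveRowToTop {suc k} (suc l) M = begin
    det (withTopRow (M (suc l)) (suc l) M) ≈⟨ det-cong swapped ⟩
    det (swap₀₁ X)                         ≈⟨ det-swap₀₁ X ⟩
    - det X                                ≈⟨ -‿cong det-X ⟩
    - (sgn (toℕ l) * det M)                ≈⟨ -‿distribˡ-* _ _ ⟩
    - sgn (toℕ l) * det M                  ∎
    where
    X : Matrix (suc (suc k))
    X zero    = M zero
    X (suc a) = withTopRow (M (suc l)) l (λ i → M (suc i)) a
    swapped : ∀ i j → withTopRow (M (suc l)) (suc l) M i j ≈ swap₀₁ X i j
    swapped zero          j = refl
    swapped (suc zero)    j = refl
    swapped (suc (suc i)) j = refl
    minor-X : ∀ j a b → minor zero j X a b ≈ withTopRow (minor zero j M l) l (minor zero j M) a b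
    minor-X j zero    b = refl
    minor-X j (suc a) b = refl
    det-X : det X ≈ sgn (toℕ l) * det M
    det-X = begin
      ∑ (λ j → sgn (toℕ j) * (M zero j * det (minor zero j X)))
        ≈⟨ ∑-cong (λ j → *-congˡ {sgn (toℕ j)} (*-congˡ {M zero j}
             (trans (det-cong (minor-X j)) (det-moveRowToTop l (minor zero j M))))) ⟩
      ∑ (λ j → sgn (toℕ j) * (M zero j * (sgn (toℕ l) * det (minor zero j M))))
        ≈⟨ ∑-cong (λ j → solve 4 (λ s m t d → s :* (m :* (t :* d)) := t :* (s :* (m :* d))) refl
             (sgn (toℕ j)) (M zero j) (sgn (toℕ l)) (det (minor zero j M))) ⟩
      ∑ (λ j → sgn (toℕ l) * (sgn (toℕ j) * (M zero j * det (minor zero j M))))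
        ≈⟨ *-distribˡ-∑ (sgn (toℕ l)) (λ j → sgn (toℕ j) * (M zero j * det (minor zero j M))) ⟨
      sgn (toℕ l) * det M ∎

  det-equalRows : ∀ {k} {M : Matrix (suc k)} a → (∀ j → M zero j ≈ M (suc a) j) → det M ≈ 0#
  det-equalRows {suc k} {M} a row₀≈rowₐ = begin
    det M                                            ≈⟨ sgn-*-sgn (toℕ (suc a)) (det M) ⟨
    sgn (toℕ (suc a)) * (sgn (toℕ (suc a)) * det M)  ≈⟨ *-congˡ (det-moveRowToTop (suc a) M) ⟨
    sgn (toℕ (suc a)) * det M′                       ≈⟨ *-congˡ (det-equalRows₀₁ {M = M′} (sym ∘ row₀≈rowₐ)) ⟩
    sgn (toℕ (suc a)) * 0#                           ≈⟨ zeroʳ _ ⟩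
    0#                                               ∎
    where
    M′ : Matrix (suc (suc k))
    M′ = withTopRow (M (suc a)) (suc a) M

  cofactor : ∀ {k} → Fin (suc k) → Fin (suc k) → Matrix (suc k) → Carrier
  cofactor i j M = sgn (toℕ i ℕ.+ toℕ j) * det (minor i j M)

  adjugate : ∀ {k} → Matrix (suc k) → Matrix (suc k)
  adjugate M i j = cofactor j i M

  ∑-*-cofactor : ∀ {k} (r : Fin (suc k) → Carrier) l M →
                 ∑ (λ j → r j * cofactor l j M) ≈ sgn (toℕ l) * det (withTopRow r l M)
  ∑-*-cofactor r l M = begin
    ∑ (λ j → r j * (sgn (toℕ l ℕ.+ toℕ j) * det (minor l j M)))
      ≈⟨ ∑-cong (λ j → trans (*-congˡ (*-congʳ (sgn-+ (toℕ l) (toℕ j))))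
           (solve 4 (λ x s t d → x :* ((s :* t) :* d) := s :* (t :* (x :* d)))
             refl (r j) (sgn (toℕ l)) (sgn (toℕ j)) (det (minor l j M)))) ⟩
    ∑ (λ j → sgn (toℕ l) * (sgn (toℕ j) * (r j * det (minor l j M))))
      ≈⟨ *-distribˡ-∑ (sgn (toℕ l)) (λ j → sgn (toℕ j) * (r j * det (minor l j M))) ⟨
    sgn (toℕ l) * det (withTopRow r l M) ∎

  *-adjugate : ∀ {k} (M : Matrix (suc k)) i l → ∑ (λ j → M i j * adjugate M j l) ≈ δ i l * det M
  *-adjugate M i l with i Fin.≟ l
  ... | yes ≡.refl = begin
    ∑ (λ j → M i j * cofactor i j M)            ≈⟨ ∑-*-cofactor (M i) i M ⟩
    sgn (toℕ i) * det (withTopRow (M i) i M)   ≈⟨ *-congˡ (det-moveRowToTop i M) ⟩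
    sgn (toℕ i) * (sgn (toℕ i) * det M)        ≈⟨ sgn-*-sgn (toℕ i) (det M) ⟩
    det M                                      ≈⟨ *-identityˡ _ ⟨
    1# * det M                                 ≡⟨ ≡.cong (_* det M) (δ-refl i) ⟨
    δ i i * det M                              ∎
  ... | no i≢l = begin
    ∑ (λ j → M i j * cofactor l j M)            ≈⟨ ∑-*-cofactor (M i) l M ⟩
    sgn (toℕ l) * det M′                       ≈⟨ *-congˡ (det-equalRows {M = M′} (punchOut l≢i) repeated) ⟩
    sgn (toℕ l) * 0#                           ≈⟨ zeroʳ _ ⟩
    0#                                         ≈⟨ zeroˡ _ ⟨
    0# * det M                                 ≡⟨ ≡.cong (_* det M) (δ-≢ i≢l) ⟨
    δ i l * det M                              ∎
    where
    l≢i : l ≢ i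
    l≢i = i≢l ∘ ≡.sym
    M′ : Matrix _
    M′ = withTopRow (M i) l M
    repeated : ∀ j → M i j ≈ M (punchIn l (punchOut l≢i)) j
    repeated j = reflexive (≡.cong (λ t → M t j) (≡.sym (Fin.punchIn-punchOut l≢i)))

  adj𝟙 : ∀ {k} → Matrix (suc k) → Vector (suc k)
  adj𝟙 M i = ∑ (adjugate M i)

  ∑-adj𝟙 : ∀ {k} (M : Matrix (suc k)) → ∑ (adj𝟙 M) ≈ cof M
  ∑-adj𝟙 M = ∑-comm (adjugate M)

  *ᵥ-adj𝟙 : ∀ {k} (M : Matrix (suc k)) i → (M *ᵥ adj𝟙 M) i ≈ det M
  *ᵥ-adj𝟙 M i = begin
    ∑ (λ j → M i j * ∑ (adjugate M j))             ≈⟨ ∑-cong (λ j → *-distribˡ-∑ (M i j) (adjugate M j)) ⟩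
    ∑ (λ j → ∑ (λ l → M i j * adjugate M j l))     ≈⟨ ∑-comm (λ j l → M i j * adjugate M j l) ⟩
    ∑ (λ l → ∑ (λ j → M i j * adjugate M j l))     ≈⟨ ∑-cong (*-adjugate M i) ⟩
    ∑ (λ l → δ i l * det M)                        ≈⟨ ∑-δ i (λ _ → det M) ⟩
    det M                                          ∎

  adjugate-kernel : ∀ {k} (M : Matrix (suc k)) → det M ≈ 0# → ∀ l i → (M *ᵥ (λ j → adjugate M j l)) i ≈ 0#
  adjugate-kernel M det≈0 l i = trans (*-adjugate M i l) (trans (*-congˡ det≈0) (zeroʳ _))

module OrderedFieldProperties {c ℓ₁ ℓ₂} (F : OrderedField c ℓ₁ ℓ₂) where
  open OrderedField F using (_≤_; isTotalOrder; +-mono-≤; *-nonneg; inverse)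
  open CommutativeRing (OrderedField.commutativeRing F) hiding (zero)
  open import Algebra.Properties.Ring ring using (-0#≈0#; -‿involutive; -‿+-comm)
  open IntegerCoefficientSolver (OrderedField.commutativeRing F)
  open import Relation.Binary.Structures using (IsTotalOrder)
  open import Relation.Binary.Bundles using (Poset)
  open IsTotalOrder isTotalOrder using (isPartialOrder; antisym; total)
  import Relation.Binary.Reasoning.PartialOrder

  poset : Poset c ℓ₁ ℓ₂
  poset = record { isPartialOrder = isPartialOrder }

  module ≤-Reasoning = Relation.Binary.Reasoning.PartialOrder poset
  open ≤-Reasoning

  +-mono₂-≤ : ∀ {x y u v} → x ≤ y → u ≤ v → (x + u) ≤ (y + v)
  +-mono₂-≤ {x} {y} {u} {v} x≤y u≤v = begin
    x + u ≤⟨ +-mono-≤ u x≤y ⟩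
    y + u ≈⟨ +-comm y u ⟩
    u + y ≤⟨ +-mono-≤ y u≤v ⟩
    v + y ≈⟨ +-comm v y ⟩
    y + v ∎

  -‿antitone : ∀ {x y} → x ≤ y → (- y) ≤ (- x)
  -‿antitone {x} {y} x≤y = begin
    - y              ≈⟨ solve 2 (λ x y → :- y := x :+ (:- x :+ :- y)) refl x y ⟩
    x + (- x + - y)  ≤⟨ +-mono-≤ (- x + - y) x≤y ⟩
    y + (- x + - y)  ≈⟨ solve 2 (λ x y → y :+ (:- x :+ :- y) := :- x) refl x y ⟩
    - x              ∎

  -‿nonpos : ∀ {x} → 0# ≤ x → (- x) ≤ 0#
  -‿nonpos {x} 0≤x = begin - x ≤⟨ -‿antitone 0≤x ⟩ - 0# ≈⟨ -0#≈0# ⟩ 0# ∎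

  x*x-nonneg : ∀ x → 0# ≤ (x * x)
  x*x-nonneg x with total 0# x
  ... | inj₁ 0≤x = *-nonneg 0≤x 0≤x
  ... | inj₂ x≤0 = begin
    0#           ≤⟨ *-nonneg 0≤-x 0≤-x ⟩
    - x * - x    ≈⟨ solve 1 (λ x → :- x :* :- x := x :* x) refl x ⟩
    x * x        ∎
    where
    0≤-x : 0# ≤ (- x)
    0≤-x = begin 0# ≈⟨ -0#≈0# ⟨ - 0# ≤⟨ -‿antitone x≤0 ⟩ - x ∎

  nonpos-+-≈0 : ∀ {x y} → x ≤ 0# → y ≤ 0# → x + y ≈ 0# → (x ≈ 0#) × (y ≈ 0#)
  nonpos-+-≈0 {x} {y} x≤0 y≤0 x+y≈0 = antisym x≤0 0≤x , antisym y≤0 0≤y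
    where
    0≤x : 0# ≤ x
    0≤x = begin
      0#     ≈⟨ trans (sym x+y≈0) (+-comm x y) ⟩
      y + x  ≤⟨ +-mono-≤ x y≤0 ⟩
      0# + x ≈⟨ +-identityˡ x ⟩
      x      ∎
    0≤y : 0# ≤ y
    0≤y = begin
      0#     ≈⟨ sym x+y≈0 ⟩
      x + y  ≤⟨ +-mono-≤ y x≤0 ⟩
      0# + y ≈⟨ +-identityˡ y ⟩
      y      ∎

  x+x≈0⇒x≈0 : ∀ {x} → x + x ≈ 0# → x ≈ 0#
  x+x≈0⇒x≈0 {x} x+x≈0 with total x 0#
  ... | inj₁ x≤0 = proj₁ (nonpos-+-≈0 x≤0 x≤0 x+x≈0)
  ... | inj₂ 0≤x = begin-equality
    x       ≈⟨ -‿involutive x ⟨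
    - - x   ≈⟨ -‿cong (proj₁ (nonpos-+-≈0 -x≤0 -x≤0 -x+-x≈0)) ⟩
    - 0#    ≈⟨ -0#≈0# ⟩
    0#      ∎
    where
    -x≤0 : (- x) ≤ 0#
    -x≤0 = -‿nonpos 0≤x
    -x+-x≈0 : - x + - x ≈ 0#
    -x+-x≈0 = trans (-‿+-comm x x) (trans (-‿cong x+x≈0) -0#≈0#)

  *-cancelˡ-≈0 : ∀ {a x} → ¬ (a ≈ 0#) → a * x ≈ 0# → x ≈ 0#
  *-cancelˡ-≈0 {a} {x} a≉0 ax≈0 with inverse a a≉0
  ... | a⁻¹ , aa⁻¹≈1 = begin-equality
    x               ≈⟨ *-identityˡ x ⟨
    1# * x          ≈⟨ *-congʳ aa⁻¹≈1 ⟨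
    (a * a⁻¹) * x   ≈⟨ solve 3 (λ a b x → (a :* b) :* x := b :* (a :* x)) refl a a⁻¹ x ⟩
    a⁻¹ * (a * x)   ≈⟨ *-congˡ ax≈0 ⟩
    a⁻¹ * 0#        ≈⟨ zeroʳ a⁻¹ ⟩
    0#              ∎

  x*x≈0⇒¬¬x≈0 : ∀ {x} → x * x ≈ 0# → ¬ ¬ (x ≈ 0#)
  x*x≈0⇒¬¬x≈0 xx≈0 x≉0 = x≉0 (*-cancelˡ-≈0 x≉0 xx≈0)

module HollowCND {c ℓ₁ ℓ₂} (F : OrderedField c ℓ₁ ℓ₂) where
  open OrderedField F using (_≤_; +-mono-≤; 1≉0; inverse)
  open CommutativeRing (OrderedField.commutativeRing F) hiding (zero)
  open Matrices (OrderedField.commutativeRing F)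
  open FiniteSums (OrderedField.commutativeRing F)
  open QuadraticForms (OrderedField.commutativeRing F)
  open Determinants (OrderedField.commutativeRing F)
  open OrderedFieldProperties F
  open IntegerCoefficientSolver (OrderedField.commutativeRing F)
  open import Relation.Nullary.Negation using (¬¬-map)
  open import Algebra.Properties.Ring ring using (-0#≈0#)
  open ≤-Reasoning

  -- The conclusion v ≈ 0 is double-negated: equality in an ordered field need not be decidable.
  record IsHollowCND {k} (M : Matrix k) : Set (c ⊔ ℓ₁ ⊔ ℓ₂) where
    field
      symmetric : ∀ i j → M i j ≈ M j i
      hollow    : ∀ i → M i i ≈ 0#
      quad≤0    : ∀ v → ∑ v ≈ 0# → quad M v ≤ 0#
      quad≈0⇒≈0 : ∀ v → ∑ v ≈ 0# → quad M v ≈ 0# → ¬ ¬ (∀ i → v i ≈ 0#)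

  sub-isHollowCND : ∀ {k m} {M : Matrix m} {σ : Fin k → Fin m} →
                    IsHollowCND M → Injective _≡_ _≡_ σ → IsHollowCND (sub M σ)
  sub-isHollowCND {M = M} {σ} M-cnd σ-inj = record
    { symmetric = λ i j → symmetric (σ i) (σ j)
    ; hollow    = λ i → hollow (σ i)
    ; quad≤0    = λ v ∑v≈0 → begin
        quad (sub M σ) v  ≈⟨ quad-push M σ v ⟩
        quad M (push σ v) ≤⟨ quad≤0 (push σ v) (trans (∑-push σ v) ∑v≈0) ⟩
        0#                ∎
    ; quad≈0⇒≈0 = λ v ∑v≈0 q≈0 →
        ¬¬-map (λ push≈0 i → trans (sym (push-injective σ-inj v i)) (push≈0 (σ i)))
        (quad≈0⇒≈0 (push σ v) (trans (∑-push σ v) ∑v≈0) (trans (sym (quad-push M σ v)) q≈0))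
    }
    where open IsHollowCND M-cnd

  -- y i = x - (∑ x) δᵢ sums to 0 and, as M x = 0 and Mᵢᵢ = 0, has quad M (y i) = 0,
  -- so y i vanishes; reading y 0 and y 1 off their diagonals gives x = 0.
  kernel-trivial : ∀ {k} {M : Matrix (suc (suc k))} → IsHollowCND M →
                   ∀ {x} → (∀ i → (M *ᵥ x) i ≈ 0#) → ¬ ¬ (∀ i → x i ≈ 0#)
  kernel-trivial {k} {M} M-cnd {x} Mx≈0 ¬x≈0 =
    y≈0 zero (λ y₀≈0 → y≈0 (suc zero) (λ y₁≈0 → ¬x≈0 (x≈0 y₀≈0 y₁≈0)))
    where
    open IsHollowCND M-cnd
    t : Carrier
    t = - ∑ x
    e : Fin (suc (suc k)) → Vector (suc (suc k))
    e i a = δ i a * t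
    y : Fin (suc (suc k)) → Vector (suc (suc k))
    y i a = x a + e i a
    ∑y≈0 : ∀ i → ∑ (y i) ≈ 0#
    ∑y≈0 i = begin-equality
      ∑ (y i)         ≈⟨ ∑-distrib-+ x (e i) ⟩
      ∑ x + ∑ (e i)   ≈⟨ +-congˡ (∑-δ i (λ _ → t)) ⟩
      ∑ x + t         ≈⟨ -‿inverseʳ (∑ x) ⟩
      0#              ∎
    bilinear-x≈0 : ∀ u → bilinear M u x ≈ 0#
    bilinear-x≈0 u = trans (bilinear-const M u x Mx≈0) (zeroʳ _)
    quad-y≈0 : ∀ i → quad M (y i) ≈ 0#
    quad-y≈0 i = begin-equality
      quad M (y i)
        ≈⟨ quad-+ M x (e i) ⟩
      ((quad M x + bilinear M x (e i)) + bilinear M (e i) x) + quad M (e i)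
        ≈⟨ +-cong (+-cong (+-cong (bilinear-x≈0 x) (trans (bilinear-sym symmetric x (e i)) (bilinear-x≈0 (e i))))
                            (bilinear-x≈0 (e i)))
                  (trans (quad-δ M i t) (*-congˡ (trans (*-congʳ (hollow i)) (zeroˡ t)))) ⟩
      ((0# + 0#) + 0#) + t * 0#
        ≈⟨ solve 1 (λ t → ((con (+ 0) :+ con (+ 0)) :+ con (+ 0)) :+ t :* con (+ 0) := con (+ 0)) refl t ⟩
      0# ∎
    y≈0 : ∀ i → ¬ ¬ (∀ a → y i a ≈ 0#)
    y≈0 i = quad≈0⇒≈0 (y i) (∑y≈0 i) (quad-y≈0 i)
    off-diagonal : ∀ {i a} → δ i a ≡ 0# → y i a ≈ 0# → x a ≈ 0#
    off-diagonal {i} {a} δ≡0 yᵢ≈0 = begin-equality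
      x a                ≈⟨ solve 2 (λ x t → x := x :+ con (+ 0) :* t) refl (x a) t ⟩
      x a + 0# * t       ≡⟨ ≡.cong (λ d → x a + d * t) δ≡0 ⟨
      y i a              ≈⟨ yᵢ≈0 ⟩
      0#                 ∎
    x≈0 : (∀ a → y zero a ≈ 0#) → (∀ a → y (suc zero) a ≈ 0#) → ∀ a → x a ≈ 0#
    x≈0 y₀≈0 y₁≈0 zero    = off-diagonal {suc zero} ≡.refl (y₁≈0 zero)
    x≈0 y₀≈0 y₁≈0 (suc a) = off-diagonal {zero} ≡.refl (y₀≈0 (suc a))

  2×2-offDiagonal≉0 : ∀ {M : Matrix 2} → IsHollowCND M → ¬ (M (suc zero) zero ≈ 0#)
  2×2-offDiagonal≉0 {M} M-cnd M₁₀≈0 = kernel-trivial M-cnd {δ zero} Mδ₀≈0 (λ δ₀≈0 → 1≉0 (δ₀≈0 zero))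
    where
    open IsHollowCND M-cnd
    column₀≈0 : ∀ i → M i zero ≈ 0#
    column₀≈0 zero       = hollow zero
    column₀≈0 (suc zero) = M₁₀≈0
    Mδ₀≈0 : ∀ i → (M *ᵥ δ zero) i ≈ 0#
    Mδ₀≈0 i = trans (∑-cong (λ j → *-comm (M i j) (δ zero j))) (trans (∑-δ zero (M i)) (column₀≈0 i))

  -- If M were singular, the column adj M · e₀ would lie in its kernel and hence vanish, forcing
  -- M₁₀ = 0 for size 2, and otherwise det (minor 0 0 M) = 0 against the induction hypothesis.
  det≉0 : ∀ {k} {M : Matrix (suc (suc k))} → IsHollowCND M → ¬ (det M ≈ 0#)
  det≉0 {zero} {M} M-cnd det≈0 =
    kernel-trivial M-cnd {λ j → adjugate M j zero} (adjugate-kernel M det≈0 zero) λ adj₀≈0 →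
    2×2-offDiagonal≉0 M-cnd (begin-equality
      M (suc zero) zero
        ≈⟨ solve 1 (λ m → m := :- (:- con (+ 1) :* (con (+ 1) :* (m :* con (+ 1)) :+ con (+ 0)))) refl _ ⟩
      - adjugate M (suc zero) zero  ≈⟨ -‿cong (adj₀≈0 (suc zero)) ⟩
      - 0#                          ≈⟨ -0#≈0# ⟩
      0#                            ∎)
  det≉0 {suc k} {M} M-cnd det≈0 =
    kernel-trivial M-cnd {λ j → adjugate M j zero} (adjugate-kernel M det≈0 zero) λ adj₀≈0 →
    det≉0 (sub-isHollowCND M-cnd Fin.suc-injective) (trans (sym (*-identityˡ _)) (adj₀≈0 zero))

  cof≉0 : ∀ {k} {M : Matrix (suc k)} → IsHollowCND M → ¬ (cof M ≈ 0#)
  cof≉0 {zero} M-cnd cof≈0 =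
    1≉0 (trans (solve 0 (con (+ 1) := (con (+ 1) :* con (+ 1) :+ con (+ 0)) :+ con (+ 0)) refl) cof≈0)
  cof≉0 {suc k} {M} M-cnd cof≈0 = quad≈0⇒≈0 (adj𝟙 M) ∑adj𝟙≈0 quad≈0 λ adj𝟙≈0 →
    det≉0 M-cnd (begin-equality
      det M                  ≈⟨ *ᵥ-adj𝟙 M zero ⟨
      (M *ᵥ adj𝟙 M) zero     ≈⟨ ∑-zero (λ j → trans (*-congˡ {M zero j} (adj𝟙≈0 j)) (zeroʳ _)) ⟩
      0#                     ∎)
    where
    open IsHollowCND M-cnd
    ∑adj𝟙≈0 : ∑ (adj𝟙 M) ≈ 0#
    ∑adj𝟙≈0 = trans (∑-adj𝟙 M) cof≈0
    quad≈0 : quad M (adj𝟙 M) ≈ 0#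
    quad≈0 = trans (bilinear-const M (adj𝟙 M) (adj𝟙 M) (*ᵥ-adj𝟙 M)) (trans (*-congʳ ∑adj𝟙≈0) (zeroˡ _))

  quad-maximum : ∀ {k} {M : Matrix k} → IsHollowCND M → ∀ {u r} → (∀ i → (M *ᵥ u) i ≈ r) → ∑ u ≈ 1# →
                 ∀ v → ∑ v ≈ 1# → quad M v ≤ r
  quad-maximum {M = M} M-cnd {u} {r} Mu≈r ∑u≈1 v ∑v≈1 = begin
    quad M v
      ≈⟨ quad-cong (λ _ _ → refl) u+h≈v ⟨
    quad M (λ i → u i + h i)
      ≈⟨ quad-+ M u h ⟩
    ((quad M u + bilinear M u h) + bilinear M h u) + quad M h
      ≈⟨ +-congʳ (+-cong (+-cong quad-u≈r bilinear-u-h≈0) bilinear-h-u≈0) ⟩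
    ((r + 0#) + 0#) + quad M h
      ≈⟨ solve 2 (λ r q → ((r :+ con (+ 0)) :+ con (+ 0)) :+ q := q :+ r) refl r _ ⟩
    quad M h + r
      ≤⟨ +-mono-≤ r (quad≤0 h ∑h≈0) ⟩
    0# + r
      ≈⟨ +-identityˡ r ⟩
    r ∎
    where
    open IsHollowCND M-cnd
    h : Vector _
    h i = v i - u i
    u+h≈v : ∀ i → u i + h i ≈ v i
    u+h≈v i = solve 2 (λ u v → u :+ (v :- u) := v) refl (u i) (v i)
    ∑h≈0 : ∑ h ≈ 0#
    ∑h≈0 = begin-equality
      ∑ h                       ≈⟨ ∑-distrib-+ v (λ i → - u i) ⟩
      ∑ v + ∑ (λ i → - u i)     ≈⟨ +-congˡ (-‿distrib-∑ u) ⟨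
      ∑ v - ∑ u                 ≈⟨ +-cong ∑v≈1 (-‿cong ∑u≈1) ⟩
      1# - 1#                   ≈⟨ -‿inverseʳ 1# ⟩
      0#                        ∎
    quad-u≈r : quad M u ≈ r
    quad-u≈r = trans (bilinear-const M u u Mu≈r) (trans (*-congʳ ∑u≈1) (*-identityˡ r))
    bilinear-h-u≈0 : bilinear M h u ≈ 0#
    bilinear-h-u≈0 = trans (bilinear-const M h u Mu≈r) (trans (*-congʳ ∑h≈0) (zeroˡ r))
    bilinear-u-h≈0 : bilinear M u h ≈ 0#
    bilinear-u-h≈0 = trans (bilinear-sym symmetric u h) bilinear-h-u≈0

  det/cof-maximum : ∀ {k} {M : Matrix (suc k)} → IsHollowCND M →
    ¬ (cof M ≈ 0#) ×
    (∃ λ r → (cof M * r ≈ det M) ×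
             (∃ λ u → (∑ u ≈ 1#) × (quad M u ≈ r)) ×
             (∀ u → ∑ u ≈ 1# → quad M u ≤ r))
  det/cof-maximum {M = M} M-cnd with inverse (cof M) (cof≉0 M-cnd)
  ... | y , cof*y≈1 =
    cof≉0 M-cnd , det M * y , cof*r≈det , (u , ∑u≈1 , quad-u≈r) , quad-maximum M-cnd {u} Mu≈r ∑u≈1
    where
    u : Vector _
    u j = adj𝟙 M j * y
    cof*r≈det : cof M * (det M * y) ≈ det M
    cof*r≈det = begin-equality
      cof M * (det M * y)   ≈⟨ solve 3 (λ c d y → c :* (d :* y) := d :* (c :* y)) refl (cof M) (det M) y ⟩
      det M * (cof M * y)   ≈⟨ *-congˡ cof*y≈1 ⟩
      det M * 1#            ≈⟨ *-identityʳ _ ⟩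
      det M                 ∎
    ∑u≈1 : ∑ u ≈ 1#
    ∑u≈1 = trans (sym (*-distribʳ-∑ y (adj𝟙 M))) (trans (*-congʳ (∑-adj𝟙 M)) cof*y≈1)
    Mu≈r : ∀ i → (M *ᵥ u) i ≈ det M * y
    Mu≈r i = begin-equality
      ∑ (λ j → M i j * (adj𝟙 M j * y))   ≈⟨ ∑-cong (λ j → *-assoc (M i j) (adj𝟙 M j) y) ⟨
      ∑ (λ j → (M i j * adj𝟙 M j) * y)   ≈⟨ *-distribʳ-∑ y (λ j → M i j * adj𝟙 M j) ⟨
      (M *ᵥ adj𝟙 M) i * y                ≈⟨ *-congʳ (*ᵥ-adj𝟙 M i) ⟩
      det M * y                          ∎
    quad-u≈r : quad M u ≈ det M * y
    quad-u≈r = trans (bilinear-const M u u Mu≈r) (trans (*-congʳ ∑u≈1) (*-identityˡ _))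

module TreeDistances {c ℓ₁ ℓ₂} (F : OrderedField c ℓ₁ ℓ₂) where
  open OrderedField F using (_≤_; *-nonneg)
  open CommutativeRing (OrderedField.commutativeRing F) hiding (zero)
  open Tree F
  open Matrices (OrderedField.commutativeRing F)
  open FiniteSums (OrderedField.commutativeRing F)
  open QuadraticForms (OrderedField.commutativeRing F)
  open OrderedFieldProperties F
  open HollowCND F
  open IntegerCoefficientSolver (OrderedField.commutativeRing F)
  open import Algebra.Properties.Ring ring using (-0#≈0#; -‿involutive)
  open ≤-Reasoning

  dist-sym : ∀ {n} (T : WTree n) i j → dist T i j ≈ dist T j i
  dist-sym single       zero    zero    = refl
  dist-sym (grow T p α) zero    zero    = refl
  dist-sym (grow T p α) zero    (suc j) = trans (+-comm α _) (+-congʳ (dist-sym T p j))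
  dist-sym (grow T p α) (suc i) zero    = trans (+-congʳ (dist-sym T i p)) (+-comm _ α)
  dist-sym (grow T p α) (suc i) (suc j) = dist-sym T i j

  dist-hollow : ∀ {n} (T : WTree n) i → dist T i i ≈ 0#
  dist-hollow single       zero    = refl
  dist-hollow (grow T p α) zero    = refl
  dist-hollow (grow T p α) (suc i) = dist-hollow T i

  retract : ∀ {n} → Fin (suc n) → Fin (suc (suc n)) → Fin (suc n)
  retract p zero    = p
  retract p (suc i) = i

  dist-grow : ∀ {n} (T : WTree (suc n)) p α x y → dist (grow T p α) x y ≈
    dist T (retract p x) (retract p y) + α * ((δ zero x - δ zero y) * (δ zero x - δ zero y))
  dist-grow T p α zero zero = begin-equality
    0#
      ≈⟨ dist-hollow T p ⟨
    dist T p p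
      ≈⟨ solve 2 (λ d a → d := d :+ a :* ((con (+ 1) :- con (+ 1)) :* (con (+ 1) :- con (+ 1)))) refl _ α ⟩
    dist T p p + α * ((1# - 1#) * (1# - 1#)) ∎
  dist-grow T p α zero (suc j) =
    solve 2 (λ d a → a :+ d := d :+ a :* ((con (+ 1) :- con (+ 0)) :* (con (+ 1) :- con (+ 0)))) refl (dist T p j) α
  dist-grow T p α (suc i) zero =
    solve 2 (λ d a → d :+ a := d :+ a :* ((con (+ 0) :- con (+ 1)) :* (con (+ 0) :- con (+ 1)))) refl (dist T i p) α
  dist-grow T p α (suc i) (suc j) =
    solve 2 (λ d a → d := d :+ a :* ((con (+ 0) :- con (+ 0)) :* (con (+ 0) :- con (+ 0)))) refl (dist T i j) α

  push-retract : ∀ {n} (p : Fin (suc n)) v y → push (retract p) v y ≈ δ p y * v zero + v (suc y)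
  push-retract p v y =
    +-congˡ (trans (∑-cong (λ a → *-congʳ {v (suc a)} (reflexive (δ-sym a y)))) (∑-δ y (λ a → v (suc a))))

  quad-dist-grow : ∀ {n} (T : WTree (suc n)) p α v → ∑ v ≈ 0# →
    quad (dist (grow T p α)) v ≈ quad (dist T) (push (retract p) v) + - ((α + α) * (v zero * v zero))
  quad-dist-grow T p α v ∑v≈0 = begin-equality
    quad (dist (grow T p α)) v
      ≈⟨ quad-cong {u = v} (dist-grow T p α) (λ _ → refl) ⟩
    quad (λ x y → sub (dist T) (retract p) x y + α * squaredDifference x y) v
      ≈⟨ quad-+-* (sub (dist T) (retract p)) squaredDifference α v ⟩
    quad (sub (dist T) (retract p)) v + α * quad squaredDifference v
      ≈⟨ +-cong (quad-push (dist T) (retract p) v) (*-congˡ (quad-squaredDifference (δ zero) v ∑v≈0)) ⟩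
    quad (dist T) (push (retract p) v) + α * - (s * s + s * s)
      ≈⟨ +-congˡ (solve 2 (λ a s → a :* :- (s :* s :+ s :* s) := :- ((a :+ a) :* (s :* s))) refl α s) ⟩
    quad (dist T) (push (retract p) v) + - ((α + α) * (s * s))
      ≈⟨ +-congˡ (-‿cong (*-congˡ (*-cong s≈v₀ s≈v₀))) ⟩
    quad (dist T) (push (retract p) v) + - ((α + α) * (v zero * v zero)) ∎
    where
    squaredDifference : Matrix _
    squaredDifference x y = (δ zero x - δ zero y) * (δ zero x - δ zero y)
    s : Carrier
    s = ⟨ δ zero , v ⟩
    s≈v₀ : s ≈ v zero
    s≈v₀ = ∑-δ zero v

  dist-quad : ∀ {n} (T : WTree n) → PositiveLengths T → ∀ v → ∑ v ≈ 0# →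
              (quad (dist T) v ≤ 0#) × (quad (dist T) v ≈ 0# → ¬ ¬ (∀ x → v x ≈ 0#))
  dist-quad single _ v ∑v≈0 = quad≤0 , λ _ ¬v≈0 → ¬v≈0 λ { zero → trans (sym (+-identityʳ _)) ∑v≈0 }
    where
    quad≤0 : quad (dist single) v ≤ 0#
    quad≤0 = begin
      quad (dist single) v
        ≈⟨ solve 1 (λ x → (x :* (con (+ 0) :* x) :+ con (+ 0)) :+ con (+ 0) := con (+ 0)) refl (v zero) ⟩
      0# ∎
  dist-quad (grow T p α) ((0≤α , 0≉α) , T-pos) v ∑v≈0 = quad≤0 , quad≈0⇒≈0
    where
    v′ : Vector (suc _)
    v′ = push (retract p) v
    IH : (quad (dist T) v′ ≤ 0#) × (quad (dist T) v′ ≈ 0# → ¬ ¬ (∀ x → v′ x ≈ 0#))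
    IH = dist-quad T T-pos v′ (trans (∑-push (retract p) v) ∑v≈0)
    t : Carrier
    t = (α + α) * (v zero * v zero)
    0≤2α : 0# ≤ (α + α)
    0≤2α = begin 0# ≈⟨ +-identityʳ 0# ⟨ 0# + 0# ≤⟨ +-mono₂-≤ 0≤α 0≤α ⟩ α + α ∎
    -t≤0 : (- t) ≤ 0#
    -t≤0 = -‿nonpos (*-nonneg 0≤2α (x*x-nonneg (v zero)))
    decomposition : quad (dist (grow T p α)) v ≈ quad (dist T) v′ + - t
    decomposition = quad-dist-grow T p α v ∑v≈0
    quad≤0 : quad (dist (grow T p α)) v ≤ 0#
    quad≤0 = begin
      quad (dist (grow T p α)) v    ≈⟨ decomposition ⟩
      quad (dist T) v′ + - t        ≤⟨ +-mono₂-≤ (proj₁ IH) -t≤0 ⟩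
      0# + 0#                       ≈⟨ +-identityʳ 0# ⟩
      0#                            ∎
    quad≈0⇒≈0 : quad (dist (grow T p α)) v ≈ 0# → ¬ ¬ (∀ x → v x ≈ 0#)
    quad≈0⇒≈0 q≈0 ¬v≈0 = v₀≈0 λ v₀≈0 → proj₂ IH q′≈0 λ v′≈0 → ¬v≈0 λ
      { zero    → v₀≈0
      ; (suc y) → begin-equality
          v (suc y)                     ≈⟨ +-identityˡ _ ⟨
          0# + v (suc y)                ≈⟨ +-congʳ (trans (*-congˡ v₀≈0) (zeroʳ _)) ⟨
          δ p y * v zero + v (suc y)    ≈⟨ push-retract p v y ⟨
          v′ y                          ≈⟨ v′≈0 y ⟩
          0#                            ∎ }
      where
      parts : (quad (dist T) v′ ≈ 0#) × (- t ≈ 0#)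
      parts = nonpos-+-≈0 (proj₁ IH) -t≤0 (trans (sym decomposition) q≈0)
      q′≈0 : quad (dist T) v′ ≈ 0#
      q′≈0 = proj₁ parts
      t≈0 : t ≈ 0#
      t≈0 = trans (sym (-‿involutive t)) (trans (-‿cong (proj₂ parts)) -0#≈0#)
      2α≉0 : ¬ (α + α ≈ 0#)
      2α≉0 2α≈0 = 0≉α (sym (x+x≈0⇒x≈0 2α≈0))
      v₀≈0 : ¬ ¬ (v zero ≈ 0#)
      v₀≈0 = x*x≈0⇒¬¬x≈0 (*-cancelˡ-≈0 2α≉0 t≈0)

  dist-isHollowCND : ∀ {n} (T : WTree n) → PositiveLengths T → IsHollowCND (dist T)
  dist-isHollowCND T T-pos = record
    { symmetric = dist-sym T
    ; hollow    = dist-hollow T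
    ; quad≤0    = λ v ∑v≈0 → proj₁ (dist-quad T T-pos v ∑v≈0)
    ; quad≈0⇒≈0 = λ v ∑v≈0 → proj₂ (dist-quad T T-pos v ∑v≈0)
    }

strictlyIncreasing⇒injective : ∀ {k n} {σ : Fin k → Fin n} → StrictlyIncreasing σ → Injective _≡_ _≡_ σ
strictlyIncreasing⇒injective {σ = σ} σ-inc {i} {j} σi≡σj with Fin.<-cmp i j
... | tri< i<j _ _ = ⊥-elim (Fin.<⇒≢ (σ-inc i j i<j) σi≡σj)
... | tri≈ _ i≡j _ = i≡j
... | tri> _ _ j<i = ⊥-elim (Fin.<⇒≢ (σ-inc j i j<i) (≡.sym σi≡σj))

proposition4p1 : ∀ {c ℓ₁ ℓ₂} (F : OrderedField c ℓ₁ ℓ₂) →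
    let open OrderedField F
        open Tree F
        open Matrices commutativeRing
    in ∀ {n} (G : WTree (suc n)) → PositiveLengths G →
       ∀ {k} (σ : Fin (suc k) → Fin (suc n)) → StrictlyIncreasing σ →
       let DS = sub (dist G) σ
       in ¬ (cof DS ≈ 0#) ×
          (∃ λ r → (cof DS * r ≈ det DS) ×
                   (∃ λ u → (∑ u ≈ 1#) × (quad DS u ≈ r)) ×
                   (∀ u → ∑ u ≈ 1# → quad DS u ≤ r))
proposition4p1 F G G-pos σ σ-inc =
  det/cof-maximum (sub-isHollowCND (dist-isHollowCND G G-pos) (strictlyIncreasing⇒injective σ-inc))
  where
  open HollowCND F
  open TreeDistances F
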